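{- Let $\sigma,\mu,\nu\in S_\infty$ be pairwise eventually equal with $\sigma\le_{\mathrm{Bruhat}}\mu\le_{\mathrm{Bruhat}}\nu$. Then $\ell_\sigma(\nu)=\ell_\sigma(\mu)+\ell_\mu(\nu)$.
   Context: $S_\infty$ is the group of bijections $\mathbb N\to\mathbb N$, with the Bruhat order: $\sigma\le_{\mathrm{Bruhat}}\omega$ iff for every $n$, the $i$-th smallest element of $\{\sigma(1),\dots,\sigma(n)\}$ is at most the $i$-th smallest of $\{\omega(1),\dots,\omega(n)\}$ for all $i$. Eventually equal: $\sigma(n)\ne\nu(n)$ for only finitely many $n$. For $\tau\in S_\infty$, $D_i(\tau)=\{j>i:\tau(i)>\tau(j)\}$ and $\ell_i(\tau)=\sum_{n\le i}|D_n(\tau)|$. For eventually equal $\sigma\le_{\mathrm{Bruhat}}\nu$, $\ell_i(\nu)-\ell_i(\sigma)$ is eventually constant and the relative length is $\ell_\sigma(\nu)=\lim_{i\to\infty}(\ell_i(\nu)-\ell_i(\sigma))$. -}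

module Defs where

open import Data.Nat using (ℕ; zero; suc; _≤_; _<_; _<?_)
open import Data.Nat.Properties using (≤-decTotalOrder)
open import Data.Integer as ℤ using (ℤ)
open import Data.List using (List; map; upTo; filter; length)
open import Data.List.Relation.Binary.Pointwise using (Pointwise)
open import Data.Product using (∃; _×_)
open import Function.Bundles using (_↔_; Inverse)
open import Relation.Binary.PropositionalEquality using (_≡_)
import Data.List.Sort.InsertionSort ≤-decTotalOrder as Sort

-- S∞ : bijections ℕ → ℕ (ℕ here starts at 0; the paper's ℕ starts at 1,
-- a harmless reindexing).
S∞ : Set
S∞ = ℕ ↔ ℕ

app : S∞ → ℕ → ℕ
app σ = Inverse.to σ

sortedPrefix : S∞ → ℕ → List ℕ
sortedPrefix σ n = Sort.sort (map (app σ) (upTo n))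

_≤B_ : S∞ → S∞ → Set
σ ≤B ω = ∀ n → Pointwise _≤_ (sortedPrefix σ n) (sortedPrefix ω n)

EventuallyEqual : S∞ → S∞ → Set
EventuallyEqual σ ν = ∃ λ N → ∀ n → N ≤ n → app σ n ≡ app ν n

-- |D_i(τ)| where D_i(τ) = {j > i : τ(i) > τ(j)}.  Each such j is τ⁻¹(v)
-- for a unique value v < τ(i); so we count the values v < τ(i) whose
-- preimage lies beyond i.  (This is the cardinality of the finite set D_i.)
cardD : S∞ → ℕ → ℕ
cardD τ i = length (filter (λ v → i <? Inverse.from τ v) (upTo (app τ i)))

ℓ : S∞ → ℕ → ℕ
ℓ τ zero    = cardD τ zero
ℓ τ (suc i) = ℓ τ i Data.Nat.+ cardD τ (suc i)

IsRelLength : S∞ → S∞ → ℤ → Set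
IsRelLength σ ν L =
  ∃ λ N → ∀ i → N ≤ i → (ℤ.+ ℓ ν i) ℤ.- (ℤ.+ ℓ σ i) ≡ L

-- If σ and ν agree from N on, then for i ≥ N the sets D_i(σ) and D_i(ν)
-- coincide, so ℓ_i(ν) − ℓ_i(σ) is constant from N on.  Evaluating all three
-- differences at one index beyond the three thresholds, the identity is the
-- telescoping (ℓ_i ν − ℓ_i σ) = (ℓ_i μ − ℓ_i σ) + (ℓ_i ν − ℓ_i μ).
{-# OPTIONS --safe #-}
module Submission where

open import Defs
open import Data.Integer using (ℤ; _+_)
open import Data.Product using (Σ-syntax; _×_)
open import Relation.Binary.PropositionalEquality using (_≡_)

open import Data.Integer as ℤ using (_-_)
open import Data.Integer.Properties using (pos-+)
open import Data.Integer.Tactic.RingSolver using (solve-∀)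
open import Data.List using (filter; length; upTo)
open import Data.List.Properties using (filter-≐)
open import Data.Nat as ℕ using (ℕ; suc; _≤_; _<_; _<?_; _≤′_; ≤′-refl; ≤′-step; _⊔_)
open import Data.Nat.Properties
  using (≤-trans; <⇒≤; m≤n⇒m≤1+n; ≤⇒≤′; ≤′⇒≤; m≤m⊔n; m≤n⊔m)
open import Data.Product using (_,_)
open import Function.Bundles using (Inverse)
open import Relation.Unary using (_≐_)
open import Relation.Binary.PropositionalEquality
  using (refl; sym; trans; cong; cong₂; subst; module ≡-Reasoning)

open Inverse using (from; strictlyInverseˡ; strictlyInverseʳ)

AgreeFrom : ℕ → S∞ → S∞ → Set
AgreeFrom N σ ν = ∀ n → N ≤ n → app σ n ≡ app ν n

agreeFrom-sym : ∀ {N σ ν} → AgreeFrom N σ ν → AgreeFrom N ν σ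
agreeFrom-sym agree n N≤n = sym (agree n N≤n)

from-agreeFrom : ∀ {N σ ν} → AgreeFrom N σ ν →
                 ∀ v → N ≤ from σ v → from σ v ≡ from ν v
from-agreeFrom {σ = σ} {ν} agree v N≤b = begin
  b                  ≡⟨ strictlyInverseʳ ν b ⟨
  from ν (app ν b)   ≡⟨ cong (from ν) (agree b N≤b) ⟨
  from ν (app σ b)   ≡⟨ cong (from ν) (strictlyInverseˡ σ v) ⟩
  from ν v           ∎
  where
  open ≡-Reasoning
  b = from σ v

later-preimage : ∀ {N σ ν i} → AgreeFrom N σ ν → N ≤ i →
                 ∀ {v} → i < from σ v → i < from ν v
later-preimage {σ = σ} {ν} {i} agree N≤i {v} i<b =
  subst (i <_) (from-agreeFrom {σ = σ} {ν} agree v (≤-trans N≤i (<⇒≤ i<b))) i<b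

cardD-agreeFrom : ∀ {N σ ν i} → AgreeFrom N σ ν → N ≤ i → cardD σ i ≡ cardD ν i
cardD-agreeFrom {σ = σ} {ν} {i} agree N≤i = begin
  length (filter (λ v → i <? from σ v) (upTo (app σ i)))
    ≡⟨ cong (λ n → length (filter (λ v → i <? from σ v) (upTo n))) (agree i N≤i) ⟩
  length (filter (λ v → i <? from σ v) (upTo (app ν i)))
    ≡⟨ cong length (filter-≐ (λ v → i <? from σ v) (λ v → i <? from ν v) same (upTo (app ν i))) ⟩
  length (filter (λ v → i <? from ν v) (upTo (app ν i)))
    ∎
  where
  open ≡-Reasoning
  same : (λ v → i < from σ v) ≐ (λ v → i < from ν v)
  same = later-preimage {σ = σ} {ν} agree N≤i
       , later-preimage {σ = ν} {σ} (agreeFrom-sym {σ = σ} {ν} agree) N≤i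

ℓ-gap : S∞ → S∞ → ℕ → ℤ
ℓ-gap σ ν i = ℤ.+ ℓ ν i - ℤ.+ ℓ σ i

+-cancelʳ-minus : ∀ (x y z : ℤ) → (x + z) - (y + z) ≡ x - y
+-cancelʳ-minus = solve-∀

minus-telescope : ∀ (x y z : ℤ) → z - x ≡ (y - x) + (z - y)
minus-telescope = solve-∀

ℓ-gap-suc : ∀ {N σ ν i} → AgreeFrom N σ ν → N ≤ i → ℓ-gap σ ν (suc i) ≡ ℓ-gap σ ν i
ℓ-gap-suc {σ = σ} {ν} {i} agree N≤i = begin
  ℤ.+ (ℓ ν i ℕ.+ cardD ν (suc i)) - ℤ.+ (ℓ σ i ℕ.+ cardD σ (suc i))
    ≡⟨ cong (λ c → ℤ.+ (ℓ ν i ℕ.+ cardD ν (suc i)) - ℤ.+ (ℓ σ i ℕ.+ c))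
            (cardD-agreeFrom {σ = σ} {ν} agree (m≤n⇒m≤1+n N≤i)) ⟩
  ℤ.+ (ℓ ν i ℕ.+ c) - ℤ.+ (ℓ σ i ℕ.+ c)
    ≡⟨ cong₂ _-_ (pos-+ (ℓ ν i) c) (pos-+ (ℓ σ i) c) ⟩
  (ℤ.+ ℓ ν i + ℤ.+ c) - (ℤ.+ ℓ σ i + ℤ.+ c)
    ≡⟨ +-cancelʳ-minus (ℤ.+ ℓ ν i) (ℤ.+ ℓ σ i) (ℤ.+ c) ⟩
  ℓ-gap σ ν i
    ∎
  where
  open ≡-Reasoning
  c = cardD ν (suc i)

constant-from : ∀ {a} {A : Set a} {N} (f : ℕ → A) →
                (∀ i → N ≤ i → f (suc i) ≡ f i) → ∀ i → N ≤ i → f i ≡ f N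
constant-from {N = N} f step i N≤i = go (≤⇒≤′ N≤i)
  where
  go : ∀ {i} → N ≤′ i → f i ≡ f N
  go ≤′-refl        = refl
  go (≤′-step N≤′i) = trans (step _ (≤′⇒≤ N≤′i)) (go N≤′i)

isRelLength-ℓ-gap : ∀ {N σ ν M} → AgreeFrom N σ ν → N ≤ M → IsRelLength σ ν (ℓ-gap σ ν M)
isRelLength-ℓ-gap {σ = σ} {ν} {M} agree N≤M =
  M , constant-from (ℓ-gap σ ν) (λ i M≤i → ℓ-gap-suc agree (≤-trans N≤M M≤i))

mainTheorem15 : (σ μ ν : S∞) →
    EventuallyEqual σ μ → EventuallyEqual μ ν → EventuallyEqual σ ν →
    σ ≤B μ → μ ≤B ν →
    Σ[ a ∈ ℤ ] Σ[ b ∈ ℤ ] Σ[ c ∈ ℤ ]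
    (IsRelLength σ ν a × IsRelLength σ μ b × IsRelLength μ ν c × a ≡ b + c)
mainTheorem15 σ μ ν (N₁ , σ≈μ) (N₂ , μ≈ν) (N₃ , σ≈ν) _ _ =
  ℓ-gap σ ν M , ℓ-gap σ μ M , ℓ-gap μ ν M ,
  isRelLength-ℓ-gap σ≈ν N₃≤M ,
  isRelLength-ℓ-gap σ≈μ N₁≤M ,
  isRelLength-ℓ-gap μ≈ν N₂≤M ,
  minus-telescope (ℤ.+ ℓ σ M) (ℤ.+ ℓ μ M) (ℤ.+ ℓ ν M)
  where
  M = N₁ ⊔ N₂ ⊔ N₃
  N₁≤M : N₁ ≤ M
  N₁≤M = ≤-trans (m≤m⊔n N₁ N₂) (m≤m⊔n (N₁ ⊔ N₂) N₃)
  N₂≤M : N₂ ≤ M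
  N₂≤M = ≤-trans (m≤n⊔m N₁ N₂) (m≤m⊔n (N₁ ⊔ N₂) N₃)
  N₃≤M : N₃ ≤ M
  N₃≤M = m≤n⊔m (N₁ ⊔ N₂) N₃
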